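{- Let $\Phi$ be irreducible with highest root $\gamma$. Fix $w\in W$ and $\beta\in\Phi^+$. Then there is at most one $v\in W$ such that $v>w$ in Bruhat order, $\beta\in N_w^\gamma\cap N_v$, $\ell_\gamma(w)=\ell_\gamma(v)$, and $v^{ -1}\beta=-\gamma$.
   Context: $\Phi$ is a crystallographic root system in a real inner product space with base $\Delta$, positive roots $\Phi^+$, $\Phi^-=-\Phi^+$; $s_\alpha$ is the reflection in $\alpha$, $W$ the Weyl group. Order on $\Phi$: $\alpha\preceq\beta$ iff $\beta-\alpha$ is a nonnegative integer combination of simple roots. $\Phi$ irreducible means it is not a disjoint union of two nonempty root systems; then there is a unique highest root $\gamma$ with $\alpha\preceq\gamma$ for all $\alpha\in\Phi$. Bruhat order $<$ on $W$: transitive closure of $u<s_\alpha u$ for $\alpha\in\Phi^+$ with $(s_\alpha u)^{ -1}\alpha\in\Phi^-$. Let $\mathfrak h_\gamma=\Phi^+\setminus\{\gamma\}$. For $w\in W$: $N_w=\{\beta\in\Phi^+:w^{ -1}\beta\in\Phi^-\}$, $N_w^\gamma=\{\beta\in\Phi^+:w^{ -1}\beta\in-\mathfrak h_\gamma\}$, $\ell_\gamma(w)=|N_w^\gamma|$.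
   Formalization: The root system Φ lies in a rational coordinate space with the standard dot product instead of a real inner product space. -}

module Defs where

open import Level using (0ℓ)
open import Data.Nat as ℕ using (ℕ)
open import Data.Integer as ℤ using (ℤ)
open import Data.Rational as ℚ using (ℚ; 0ℚ; 1ℚ; _/_; _*_; _+_; -_; _÷_; ≢-nonZero)
open import Data.Vec as Vec using (Vec; []; _∷_; zipWith; replicate)
open import Data.List as List using (List; foldr; foldl; length)
open import Data.List.Membership.Propositional using (_∈_)
open import Data.Vec.Membership.Propositional renaming (_∈_ to _∈ᵥ_) using ()
open import Data.List.Relation.Unary.All using (All)
open import Data.List.Relation.Unary.Unique.Propositional using (Unique)
open import Data.Product using (Σ; ∃; _×_; _,_)
open import Data.Sum using (_⊎_)
open import Data.Bool using (Bool; true; false)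
open import Relation.Nullary using (¬_; yes; no)
open import Relation.Binary.PropositionalEquality using (_≡_; _≢_)
open import Function.Bundles using (_⇔_)

V : ℕ → Set
V m = Vec ℚ m

infixl 6 _+ᵥ_ _-ᵥ_
infixl 7 _*ₛ_

_+ᵥ_ : ∀ {m} → V m → V m → V m
_+ᵥ_ = zipWith _+_

negᵥ : ∀ {m} → V m → V m
negᵥ = Vec.map -_

_-ᵥ_ : ∀ {m} → V m → V m → V m
x -ᵥ y = x +ᵥ negᵥ y

_*ₛ_ : ∀ {m} → ℚ → V m → V m
c *ₛ x = Vec.map (c *_) x

0ᵥ : ∀ {m} → V m
0ᵥ = replicate _ 0ℚ

⟪_,_⟫ : ∀ {m} → V m → V m → ℚ
⟪ x , y ⟫ = Vec.foldr _ _+_ 0ℚ (zipWith _*_ x y)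

2ℚ : ℚ
2ℚ = ℤ.+ 2 / 1

ℕ→ℚ : ℕ → ℚ
ℕ→ℚ n = ℤ.+ n / 1

ℤ→ℚ : ℤ → ℚ
ℤ→ℚ k = k / 1

-- Cartan number ⟨x,α⟩ = 2(x,α)/(α,α)  (set to 0 in the degenerate case α = 0,
-- which never occurs for roots).
cartan : ∀ {m} → V m → V m → ℚ
cartan x α with ⟪ α , α ⟫ ℚ.≟ 0ℚ
... | yes _ = 0ℚ
... | no ne = (2ℚ * ⟪ x , α ⟫) ÷ ⟪ α , α ⟫
  where instance _ = ≢-nonZero ne

reflect : ∀ {m} → V m → V m → V m
reflect α x = x -ᵥ (cartan x α *ₛ α)

record RootSystem (m : ℕ) : Set where
  field
    Φ              : List (V m)
    zero∉Φ         : ¬ (0ᵥ ∈ Φ)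
    reduced        : ∀ {α} (c : ℚ) → α ∈ Φ → (c *ₛ α) ∈ Φ → c ≡ 1ℚ ⊎ c ≡ - 1ℚ
    reflect-closed : ∀ {α β} → α ∈ Φ → β ∈ Φ → reflect α β ∈ Φ
    crystallographic : ∀ {α β} → α ∈ Φ → β ∈ Φ → ∃ λ (k : ℤ) → cartan β α ≡ ℤ→ℚ k

open RootSystem public

Irreducible : ∀ {m} → RootSystem m → Set
Irreducible R =
  (P : V _ → Bool) →
  (∀ {α β} → α ∈ Φ R → β ∈ Φ R → P α ≡ true → P β ≡ false → ⟪ α , β ⟫ ≡ 0ℚ) →
  (∀ {α} → α ∈ Φ R → P α ≡ true) ⊎ (∀ {α} → α ∈ Φ R → P α ≡ false)

lincomb : ∀ {m r} → Vec ℚ r → Vec (V m) r → V m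
lincomb [] [] = 0ᵥ
lincomb (c ∷ cs) (δ ∷ δs) = (c *ₛ δ) +ᵥ lincomb cs δs

lincombℕ : ∀ {m r} → Vec ℕ r → Vec (V m) r → V m
lincombℕ c = lincomb (Vec.map ℕ→ℚ c)

record Base {m} (R : RootSystem m) (r : ℕ) : Set where
  field
    Δ         : Vec (V m) r
    Δ⊆Φ       : ∀ {δ} → δ ∈ᵥ Δ → δ ∈ Φ R
    linIndep  : ∀ (c : Vec ℚ r) → lincomb c Δ ≡ 0ᵥ → c ≡ replicate r 0ℚ
    spanning  : ∀ {β} → β ∈ Φ R →
                (∃ λ (c : Vec ℕ r) → β ≡ lincombℕ c Δ) ⊎
                (∃ λ (c : Vec ℕ r) → β ≡ negᵥ (lincombℕ c Δ))

open Base public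

module _ {m r} {R : RootSystem m} (B : Base R r) where

  Pos : V m → Set
  Pos β = β ∈ Φ R × ∃ λ (c : Vec ℕ r) → β ≡ lincombℕ c (Δ B)

  Neg : V m → Set
  Neg β = Pos (negᵥ β)

  _⪯_ : V m → V m → Set
  α ⪯ β = ∃ λ (c : Vec ℕ r) → β ≡ α +ᵥ lincombℕ c (Δ B)

-- Weyl group elements: words s_{α₁} ⋯ s_{αₖ} in reflections by roots.
record W {m} (R : RootSystem m) : Set where
  constructor word
  field
    roots   : List (V m)
    inΦ     : All (_∈ Φ R) roots

open W public

act : ∀ {m} {R : RootSystem m} → W R → V m → V m
act w x = foldr reflect x (roots w)

actInv : ∀ {m} {R : RootSystem m} → W R → V m → V m
actInv w x = foldl (λ y α → reflect α y) x (roots w)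

_≈W_ : ∀ {m} {R : RootSystem m} → W R → W R → Set
u ≈W v = ∀ x → act u x ≡ act v x

module _ {m r} {R : RootSystem m} (B : Base R r) where

  BruhatStep : W R → W R → Set
  BruhatStep u v = ∃ λ α → Pos B α × (∀ x → act v x ≡ reflect α (act u x))
                              × Neg B (actInv v α)

  data _<B_ : W R → W R → Set where
    step  : ∀ {u v} → BruhatStep u v → u <B v
    trans : ∀ {u v t} → u <B v → v <B t → u <B t

  N : W R → V m → Set
  N w β = Pos B β × Neg B (actInv w β)

  𝔥 : V m → V m → Set
  𝔥 γ α = Pos B α × α ≢ γ

  Nγ : V m → W R → V m → Set
  Nγ γ w β = Pos B β × 𝔥 γ (negᵥ (actInv w β))

HasCard : ∀ {m} → (V m → Set) → ℕ → Set
HasCard P n = Σ (List (V _)) λ L → Unique L × (∀ β → (β ∈ L) ⇔ P β) × length L ≡ n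

SameCard : ∀ {m} → (V m → Set) → (V m → Set) → Set
SameCard P Q = ∃ λ n → HasCard P n × HasCard Q n

module _ {m r} {R : RootSystem m} (B : Base R r) where

  SameℓΓ : V m → W R → W R → Set
  SameℓΓ γ w v = SameCard (Nγ B γ w) (Nγ B γ v)

  Candidate : V m → W R → V m → W R → Set
  Candidate γ w β v =
    _<B_ B w v × Nγ B γ w β × N B v β × SameℓΓ γ w v × actInv v β ≡ negᵥ γ

-- If w < v is a chain of k Bruhat steps u′ = s_α u, each step injects N_u into N_u′ ∖ {α}
-- (x ↦ s_α x when s_α x > 0, x ↦ x otherwise), so |N_v| ≥ |N_w| + k.  If v⁻¹β = -γ, then β is
-- the only element of N_v outside N_v^γ, so ℓ_γ(w) = ℓ_γ(v) gives
-- |N_v| ≤ ℓ_γ(v) + 1 = ℓ_γ(w) + 1 ≤ |N_w| + 1.  Hence k = 1 and v = s_α w.  Then β = s_α ν for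
-- ν = w(-γ), and β ≠ ν because β ∈ N_w^γ, so c α = ν - β with c ≠ 0; as Φ is reduced this
-- determines the positive root α, hence v.

module Submission where

open import Defs renaming (trans to <B-trans)

open import Data.Nat as ℕ using (ℕ; zero; suc)
import Data.Nat.Properties as ℕP
import Data.Nat.Coprimality as Coprime
open import Data.Integer as ℤ using (+_; -[1+_])
import Data.Integer.Properties as ℤP
open import Data.Rational as ℚ using (ℚ; mkℚ; 0ℚ; 1ℚ; _+_; _*_; -_; _≤_; _<_)
import Data.Rational.Properties as ℚP
open import Data.Rational.Solver using (module +-*-Solver)
open +-*-Solver using (solve; _:+_; _:*_; :-_; _:=_; con)
open import Data.Vec as Vec using (Vec; []; _∷_)
import Data.Vec.Properties as VecP
open import Data.Fin using (Fin; zero; suc)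
open import Data.Fin.Properties using (injective⇒≤)
open import Data.List as List using (List; []; _∷_)
open import Data.List.Membership.Propositional using (_∈_)
open import Data.List.Membership.Propositional.Properties using (∈-lookup)
open import Data.List.Relation.Unary.All as All using (All; []; _∷_)
open import Data.List.Relation.Unary.AllPairs using ([]; _∷_)
open import Data.List.Relation.Unary.Any using (here; there; index)
open import Data.List.Relation.Unary.Any.Properties using (lookup-index)
open import Data.List.Relation.Unary.Unique.Propositional using (Unique)
open import Data.List.Relation.Binary.Pointwise using (Pointwise; []; _∷_; Pointwise-length)
open import Data.List.Relation.Binary.Subset.Propositional using (_⊆_)
open import Data.Empty using (⊥-elim)
open import Data.Product using (∃; _×_; _,_; proj₁; proj₂)
open import Data.Sum using (_⊎_; inj₁; inj₂; [_,_]′)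
open import Function using (_∘_)
open import Function.Bundles using (Equivalence)
open import Relation.Nullary using (¬_; yes; no)
open import Relation.Binary.Definitions using (tri<; tri≈; tri>)
open import Relation.Binary.PropositionalEquality hiding ([_])
open ≡-Reasoning

ℕ→ℚ≡mkℚ : ∀ n → ℕ→ℚ n ≡ mkℚ (+ n) 0 (Coprime.sym (Coprime.1-coprimeTo n))
ℕ→ℚ≡mkℚ n = ℚP.normalize-coprime (Coprime.sym (Coprime.1-coprimeTo n))

ℕ→ℚ-+ : ∀ a b → ℕ→ℚ (a ℕ.+ b) ≡ ℕ→ℚ a + ℕ→ℚ b
ℕ→ℚ-+ a b rewrite ℕ→ℚ≡mkℚ a | ℕ→ℚ≡mkℚ b =
  cong (ℚ._/ 1) (cong₂ ℤ._+_ (sym (ℤP.*-identityʳ (+ a))) (sym (ℤP.*-identityʳ (+ b))))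

ℕ→ℚ-* : ∀ a b → ℕ→ℚ (a ℕ.* b) ≡ ℕ→ℚ a * ℕ→ℚ b
ℕ→ℚ-* a b rewrite ℕ→ℚ≡mkℚ a | ℕ→ℚ≡mkℚ b = cong (ℚ._/ 1) (ℤP.pos-* a b)

ℕ→ℚ-injective : ∀ {a b} → ℕ→ℚ a ≡ ℕ→ℚ b → a ≡ b
ℕ→ℚ-injective {a} {b} eq =
  ℤP.+-injective (cong ℚ.↥_ (trans (sym (ℕ→ℚ≡mkℚ a)) (trans eq (ℕ→ℚ≡mkℚ b))))

negᵥ-involutive : ∀ {m} (x : V m) → negᵥ (negᵥ x) ≡ x
negᵥ-involutive [] = refl
negᵥ-involutive (a ∷ x) = cong₂ _∷_ (solve 1 (λ a → :- (:- a) := a) refl a) (negᵥ-involutive x)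

+ᵥ-identityʳ : ∀ {m} (x : V m) → x +ᵥ 0ᵥ ≡ x
+ᵥ-identityʳ [] = refl
+ᵥ-identityʳ (a ∷ x) = cong₂ _∷_ (ℚP.+-identityʳ a) (+ᵥ-identityʳ x)

+ᵥ-inverseʳ : ∀ {m} (x : V m) → x -ᵥ x ≡ 0ᵥ
+ᵥ-inverseʳ [] = refl
+ᵥ-inverseʳ (a ∷ x) = cong₂ _∷_ (ℚP.+-inverseʳ a) (+ᵥ-inverseʳ x)

*ₛ-identityˡ : ∀ {m} (x : V m) → 1ℚ *ₛ x ≡ x
*ₛ-identityˡ [] = refl
*ₛ-identityˡ (a ∷ x) = cong₂ _∷_ (ℚP.*-identityˡ a) (*ₛ-identityˡ x)

*ₛ-zeroʳ : ∀ {m} c → c *ₛ 0ᵥ {m} ≡ 0ᵥ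
*ₛ-zeroʳ {m} c = trans (VecP.map-replicate (c *_) 0ℚ m) (cong (Vec.replicate m) (ℚP.*-zeroʳ c))

*ₛ-assoc : ∀ {m} c d (x : V m) → (c * d) *ₛ x ≡ c *ₛ (d *ₛ x)
*ₛ-assoc c d [] = refl
*ₛ-assoc c d (a ∷ x) = cong₂ _∷_ (ℚP.*-assoc c d a) (*ₛ-assoc c d x)

negᵥ-*ₛ : ∀ {m} c (x : V m) → negᵥ (c *ₛ x) ≡ (- c) *ₛ x
negᵥ-*ₛ c [] = refl
negᵥ-*ₛ c (a ∷ x) = cong₂ _∷_ (ℚP.neg-distribˡ-* c a) (negᵥ-*ₛ c x)

negᵥ≡-1*ₛ : ∀ {m} (x : V m) → negᵥ x ≡ (- 1ℚ) *ₛ x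
negᵥ≡-1*ₛ x = trans (cong negᵥ (sym (*ₛ-identityˡ x))) (negᵥ-*ₛ 1ℚ x)

x-[x-y]≡y : ∀ {m} (x y : V m) → x -ᵥ (x -ᵥ y) ≡ y
x-[x-y]≡y [] [] = refl
x-[x-y]≡y (a ∷ x) (b ∷ y) =
  cong₂ _∷_ (solve 2 (λ a b → a :+ :- (a :+ :- b) := b) refl a b) (x-[x-y]≡y x y)

negᵥ-distrib-ᵥ : ∀ {m} (x y : V m) → negᵥ (x -ᵥ y) ≡ negᵥ x +ᵥ y
negᵥ-distrib-ᵥ [] [] = refl
negᵥ-distrib-ᵥ (a ∷ x) (b ∷ y) =
  cong₂ _∷_ (solve 2 (λ a b → :- (a :+ :- b) := :- a :+ b) refl a b) (negᵥ-distrib-ᵥ x y)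

-- Inner product, Cartan numbers and reflections

⟪⟫-linearˡ-+ᵥ : ∀ {m} (x y z : V m) → ⟪ x +ᵥ y , z ⟫ ≡ ⟪ x , z ⟫ + ⟪ y , z ⟫
⟪⟫-linearˡ-+ᵥ [] [] [] = sym (ℚP.+-identityʳ 0ℚ)
⟪⟫-linearˡ-+ᵥ (a ∷ x) (b ∷ y) (c ∷ z) rewrite ⟪⟫-linearˡ-+ᵥ x y z =
  solve 5 (λ a b c p q → (a :+ b) :* c :+ (p :+ q) := (a :* c :+ p) :+ (b :* c :+ q))
    refl a b c ⟪ x , z ⟫ ⟪ y , z ⟫

⟪⟫-linearˡ-*ₛ : ∀ {m} k (x z : V m) → ⟪ k *ₛ x , z ⟫ ≡ k * ⟪ x , z ⟫
⟪⟫-linearˡ-*ₛ k [] [] = sym (ℚP.*-zeroʳ k)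
⟪⟫-linearˡ-*ₛ k (a ∷ x) (c ∷ z) rewrite ⟪⟫-linearˡ-*ₛ k x z =
  solve 4 (λ k a c p → k :* a :* c :+ k :* p := k :* (a :* c :+ p)) refl k a c ⟪ x , z ⟫

square-pos : ∀ p → p ≢ 0ℚ → 0ℚ < p * p
square-pos p p≢0 with ℚP.<-cmp p 0ℚ
... | tri< p<0 _ _ = ℚP.positive⁻¹ (p * p) {{ℚP.neg*neg⇒pos p {{ℚ.negative p<0}} p {{ℚ.negative p<0}}}}
... | tri≈ _ p≡0 _ = ⊥-elim (p≢0 p≡0)
... | tri> _ _ p>0 = ℚP.positive⁻¹ (p * p) {{ℚP.pos*pos⇒pos p {{ℚ.positive p>0}} p {{ℚ.positive p>0}}}}

square-nonNeg : ∀ p → 0ℚ ≤ p * p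
square-nonNeg p with p ℚ.≟ 0ℚ
... | yes refl = ℚP.≤-refl
... | no p≢0 = ℚP.<⇒≤ (square-pos p p≢0)

⟪x,x⟫-nonNeg : ∀ {m} (x : V m) → 0ℚ ≤ ⟪ x , x ⟫
⟪x,x⟫-nonNeg [] = ℚP.≤-refl
⟪x,x⟫-nonNeg (a ∷ x) = ℚP.+-mono-≤ (square-nonNeg a) (⟪x,x⟫-nonNeg x)

⟪x,x⟫≡0⇒x≡0 : ∀ {m} (x : V m) → ⟪ x , x ⟫ ≡ 0ℚ → x ≡ 0ᵥ
⟪x,x⟫≡0⇒x≡0 [] _ = refl
⟪x,x⟫≡0⇒x≡0 (a ∷ x) eq with a ℚ.≟ 0ℚ
... | yes refl = cong (0ℚ ∷_) (⟪x,x⟫≡0⇒x≡0 x (trans (sym (ℚP.+-identityˡ _)) eq))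
... | no a≢0 = ⊥-elim (ℚP.<-irrefl (sym eq) 0<⟪a∷x,a∷x⟫)
  where
  0<⟪a∷x,a∷x⟫ : 0ℚ < a * a + ⟪ x , x ⟫
  0<⟪a∷x,a∷x⟫ = subst (_< a * a + ⟪ x , x ⟫) (ℚP.+-identityʳ 0ℚ)
                  (ℚP.+-mono-<-≤ (square-pos a a≢0) (⟪x,x⟫-nonNeg x))

cartan-+ᵥ : ∀ {m} (x y α : V m) → cartan (x +ᵥ y) α ≡ cartan x α + cartan y α
cartan-+ᵥ x y α with ⟪ α , α ⟫ ℚ.≟ 0ℚ
... | yes _ = refl
... | no ⟪α,α⟫≢0 rewrite ⟪⟫-linearˡ-+ᵥ x y α =
  solve 4 (λ p q i t → t :* (p :+ q) :* i := t :* p :* i :+ t :* q :* i)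
    refl ⟪ x , α ⟫ ⟪ y , α ⟫ (ℚ.1/ ⟪ α , α ⟫) 2ℚ
  where
  instance
    ⟪α,α⟫-nonZero : ℚ.NonZero ⟪ α , α ⟫
    ⟪α,α⟫-nonZero = ℚ.≢-nonZero ⟪α,α⟫≢0

cartan-*ₛ : ∀ {m} k (x α : V m) → cartan (k *ₛ x) α ≡ k * cartan x α
cartan-*ₛ k x α with ⟪ α , α ⟫ ℚ.≟ 0ℚ
... | yes _ = sym (ℚP.*-zeroʳ k)
... | no ⟪α,α⟫≢0 rewrite ⟪⟫-linearˡ-*ₛ k x α =
  solve 4 (λ k p i t → t :* (k :* p) :* i := k :* (t :* p :* i))
    refl k ⟪ x , α ⟫ (ℚ.1/ ⟪ α , α ⟫) 2ℚ
  where
  instance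
    ⟪α,α⟫-nonZero : ℚ.NonZero ⟪ α , α ⟫
    ⟪α,α⟫-nonZero = ℚ.≢-nonZero ⟪α,α⟫≢0

cartan-self : ∀ {m} (α : V m) → α ≢ 0ᵥ → cartan α α ≡ 2ℚ
cartan-self α α≢0 with ⟪ α , α ⟫ ℚ.≟ 0ℚ
... | yes ⟪α,α⟫≡0 = ⊥-elim (α≢0 (⟪x,x⟫≡0⇒x≡0 α ⟪α,α⟫≡0))
... | no ⟪α,α⟫≢0 = begin
  2ℚ * ⟪ α , α ⟫ * ℚ.1/ ⟪ α , α ⟫   ≡⟨ ℚP.*-assoc 2ℚ ⟪ α , α ⟫ (ℚ.1/ ⟪ α , α ⟫) ⟩
  2ℚ * (⟪ α , α ⟫ * ℚ.1/ ⟪ α , α ⟫) ≡⟨ cong (2ℚ *_) (ℚP.*-inverseʳ ⟪ α , α ⟫) ⟩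
  2ℚ * 1ℚ                           ≡⟨ ℚP.*-identityʳ 2ℚ ⟩
  2ℚ                                ∎
  where
  instance
    ⟪α,α⟫-nonZero : ℚ.NonZero ⟪ α , α ⟫
    ⟪α,α⟫-nonZero = ℚ.≢-nonZero ⟪α,α⟫≢0

reflect-+ᵥ : ∀ {m} (α x y : V m) → reflect α (x +ᵥ y) ≡ reflect α x +ᵥ reflect α y
reflect-+ᵥ α x y rewrite cartan-+ᵥ x y α = distrib x y α (cartan x α) (cartan y α)
  where
  distrib : ∀ {m} (x y α : V m) a b →
            (x +ᵥ y) -ᵥ ((a + b) *ₛ α) ≡ (x -ᵥ (a *ₛ α)) +ᵥ (y -ᵥ (b *ₛ α))
  distrib [] [] [] a b = refl
  distrib (p ∷ x) (q ∷ y) (c ∷ α) a b = cong₂ _∷_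
    (solve 5 (λ p q c a b → (p :+ q) :+ :- ((a :+ b) :* c) := (p :+ :- (a :* c)) :+ (q :+ :- (b :* c)))
       refl p q c a b)
    (distrib x y α a b)

reflect-*ₛ : ∀ {m} (α : V m) k x → reflect α (k *ₛ x) ≡ k *ₛ reflect α x
reflect-*ₛ α k x rewrite cartan-*ₛ k x α = distrib x α (cartan x α)
  where
  distrib : ∀ {m} (x α : V m) a → (k *ₛ x) -ᵥ ((k * a) *ₛ α) ≡ k *ₛ (x -ᵥ (a *ₛ α))
  distrib [] [] a = refl
  distrib (p ∷ x) (c ∷ α) a = cong₂ _∷_
    (solve 4 (λ k p c a → k :* p :+ :- ((k :* a) :* c) := k :* (p :+ :- (a :* c))) refl k p c a)
    (distrib x α a)

reflect-self : ∀ {m} (α : V m) → α ≢ 0ᵥ → reflect α α ≡ negᵥ α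
reflect-self α α≢0 rewrite cartan-self α α≢0 = α-2α≡-α α
  where
  α-2α≡-α : ∀ {m} (α : V m) → α -ᵥ (2ℚ *ₛ α) ≡ negᵥ α
  α-2α≡-α [] = refl
  α-2α≡-α (c ∷ α) = cong₂ _∷_ (solve 1 (λ c → c :+ :- (con 2ℚ :* c) := :- c) refl c) (α-2α≡-α α)

reflect-involutive : ∀ {m} (α : V m) → α ≢ 0ᵥ → ∀ x → reflect α (reflect α x) ≡ x
reflect-involutive α α≢0 x = begin
  reflect α (x -ᵥ (a *ₛ α))                  ≡⟨ reflect-+ᵥ α x _ ⟩
  reflect α x +ᵥ reflect α (negᵥ (a *ₛ α))   ≡⟨ cong (λ y → reflect α x +ᵥ reflect α y) (negᵥ-*ₛ a α) ⟩
  reflect α x +ᵥ reflect α ((- a) *ₛ α)      ≡⟨ cong (reflect α x +ᵥ_) (reflect-*ₛ α (- a) α) ⟩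
  reflect α x +ᵥ ((- a) *ₛ reflect α α)      ≡⟨ cong (λ y → reflect α x +ᵥ ((- a) *ₛ y))
                                                     (reflect-self α α≢0) ⟩
  (x -ᵥ (a *ₛ α)) +ᵥ ((- a) *ₛ negᵥ α)       ≡⟨ cancel x α ⟩
  x                                          ∎
  where
  a : ℚ
  a = cartan x α
  cancel : ∀ {m} (x α : V m) → (x -ᵥ (a *ₛ α)) +ᵥ ((- a) *ₛ negᵥ α) ≡ x
  cancel [] [] = refl
  cancel (p ∷ x) (c ∷ α) = cong₂ _∷_
    (solve 3 (λ a p c → (p :+ :- (a :* c)) :+ (:- a) :* (:- c) := p) refl a p c) (cancel x α)

reflect-injective : ∀ {m} {α : V m} → α ≢ 0ᵥ → ∀ {x y} → reflect α x ≡ reflect α y → x ≡ y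
reflect-injective {α = α} α≢0 {x} {y} eq = begin
  x                         ≡⟨ sym (reflect-involutive α α≢0 x) ⟩
  reflect α (reflect α x)   ≡⟨ cong (reflect α) eq ⟩
  reflect α (reflect α y)   ≡⟨ reflect-involutive α α≢0 y ⟩
  y                         ∎

reflect-fixed : ∀ {m} {α x : V m} → cartan x α ≡ 0ℚ → reflect α x ≡ x
reflect-fixed {α = α} {x} c≡0 rewrite c≡0 = x-0α≡x x α
  where
  x-0α≡x : ∀ {m} (x α : V m) → x -ᵥ (0ℚ *ₛ α) ≡ x
  x-0α≡x [] [] = refl
  x-0α≡x (p ∷ x) (a ∷ α) =
    cong₂ _∷_ (solve 2 (λ p a → p :+ :- (con 0ℚ :* a) := p) refl p a) (x-0α≡x x α)

reflect-adds : ∀ {m} {α x : V m} c → cartan x α ≡ - c → reflect α x ≡ x +ᵥ (c *ₛ α)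
reflect-adds {α = α} {x} c c≡-c rewrite c≡-c = x+cα x α
  where
  x+cα : ∀ {m} (x α : V m) → x -ᵥ ((- c) *ₛ α) ≡ x +ᵥ (c *ₛ α)
  x+cα [] [] = refl
  x+cα (p ∷ x) (a ∷ α) = cong₂ _∷_
    (solve 3 (λ c p a → p :+ :- ((:- c) :* a) := p :+ c :* a) refl c p a) (x+cα x α)

reflect≡⇒cartan*ₛ≡ : ∀ {m} {α₁ α₂ x : V m} → reflect α₁ x ≡ reflect α₂ x →
                     cartan x α₁ *ₛ α₁ ≡ cartan x α₂ *ₛ α₂
reflect≡⇒cartan*ₛ≡ {α₁ = α₁} {α₂} {x} s₁x≡s₂x = begin
  cartan x α₁ *ₛ α₁    ≡⟨ sym (x-[x-y]≡y x _) ⟩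
  x -ᵥ reflect α₁ x    ≡⟨ cong (x -ᵥ_) s₁x≡s₂x ⟩
  x -ᵥ reflect α₂ x    ≡⟨ x-[x-y]≡y x _ ⟩
  cartan x α₂ *ₛ α₂    ∎

module _ {m} (R : RootSystem m) where

  root≢0 : ∀ {α} → α ∈ Φ R → α ≢ 0ᵥ
  root≢0 α∈Φ refl = zero∉Φ R α∈Φ

  negᵥ-∈Φ : ∀ {α} → α ∈ Φ R → negᵥ α ∈ Φ R
  negᵥ-∈Φ {α} α∈Φ = subst (_∈ Φ R) (reflect-self α (root≢0 α∈Φ)) (reflect-closed R α∈Φ α∈Φ)

module _ {m} {R : RootSystem m} where

  actInv-act : (w : W R) → ∀ x → actInv w (act w x) ≡ x
  actInv-act (word [] []) x = refl
  actInv-act (word (α ∷ αs) (α∈Φ ∷ αs∈Φ)) x =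
    let w : W R
        w = word αs αs∈Φ
    in trans (cong (actInv w) (reflect-involutive α (root≢0 R α∈Φ) (act w x))) (actInv-act w x)

  act-actInv : (w : W R) → ∀ x → act w (actInv w x) ≡ x
  act-actInv (word [] []) x = refl
  act-actInv (word (α ∷ αs) (α∈Φ ∷ αs∈Φ)) x =
    let w : W R
        w = word αs αs∈Φ
    in trans (cong (reflect α) (act-actInv w (reflect α x))) (reflect-involutive α (root≢0 R α∈Φ) x)

  actInv-+ᵥ : (w : W R) → ∀ x y → actInv w (x +ᵥ y) ≡ actInv w x +ᵥ actInv w y
  actInv-+ᵥ (word [] []) x y = refl
  actInv-+ᵥ (word (α ∷ αs) (_ ∷ αs∈Φ)) x y =
    let w : W R
        w = word αs αs∈Φ
    in trans (cong (actInv w) (reflect-+ᵥ α x y)) (actInv-+ᵥ w (reflect α x) (reflect α y))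

  actInv-*ₛ : (w : W R) → ∀ k x → actInv w (k *ₛ x) ≡ k *ₛ actInv w x
  actInv-*ₛ (word [] []) k x = refl
  actInv-*ₛ (word (α ∷ αs) (_ ∷ αs∈Φ)) k x =
    let w : W R
        w = word αs αs∈Φ
    in trans (cong (actInv w) (reflect-*ₛ α k x)) (actInv-*ₛ w k (reflect α x))

  actInv-negᵥ : (w : W R) → ∀ x → actInv w (negᵥ x) ≡ negᵥ (actInv w x)
  actInv-negᵥ w x rewrite negᵥ≡-1*ₛ x | negᵥ≡-1*ₛ (actInv w x) = actInv-*ₛ w (- 1ℚ) x

  actInv-∈Φ : (w : W R) → ∀ {x} → x ∈ Φ R → actInv w x ∈ Φ R
  actInv-∈Φ (word [] []) x∈Φ = x∈Φ
  actInv-∈Φ (word (α ∷ αs) (α∈Φ ∷ αs∈Φ)) x∈Φ = actInv-∈Φ (word αs αs∈Φ) (reflect-closed R α∈Φ x∈Φ)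

  actInv-injective : (w : W R) → ∀ {x y} → actInv w x ≡ actInv w y → x ≡ y
  actInv-injective w {x} {y} eq = begin
    x                     ≡⟨ sym (act-actInv w x) ⟩
    act w (actInv w x)    ≡⟨ cong (act w) eq ⟩
    act w (actInv w y)    ≡⟨ act-actInv w y ⟩
    y                     ∎

  actInv-reflect : (w : W R) → ∀ α x → actInv w (reflect α x) ≡ actInv w x -ᵥ (cartan x α *ₛ actInv w α)
  actInv-reflect w α x = begin
    actInv w (x -ᵥ (c *ₛ α))                    ≡⟨ actInv-+ᵥ w x _ ⟩
    actInv w x +ᵥ actInv w (negᵥ (c *ₛ α))      ≡⟨ cong (actInv w x +ᵥ_) (actInv-negᵥ w (c *ₛ α)) ⟩
    actInv w x -ᵥ actInv w (c *ₛ α)             ≡⟨ cong (λ y → actInv w x -ᵥ y) (actInv-*ₛ w c α) ⟩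
    actInv w x -ᵥ (c *ₛ actInv w α)             ∎
    where
    c : ℚ
    c = cartan x α

-- Positive and negative roots

lincombℕ-+ : ∀ {m r} (a b : Vec ℕ r) (δs : Vec (V m) r) →
             lincombℕ (Vec.zipWith ℕ._+_ a b) δs ≡ lincombℕ a δs +ᵥ lincombℕ b δs
lincombℕ-+ [] [] [] = sym (+ᵥ-identityʳ 0ᵥ)
lincombℕ-+ (a ∷ as) (b ∷ bs) (δ ∷ δs) rewrite ℕ→ℚ-+ a b | lincombℕ-+ as bs δs =
  distrib δ (lincombℕ as δs) (lincombℕ bs δs)
  where
  distrib : ∀ {m} (δ x y : V m) →
            ((ℕ→ℚ a + ℕ→ℚ b) *ₛ δ) +ᵥ (x +ᵥ y) ≡ ((ℕ→ℚ a *ₛ δ) +ᵥ x) +ᵥ ((ℕ→ℚ b *ₛ δ) +ᵥ y)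
  distrib [] [] [] = refl
  distrib (d ∷ δ) (p ∷ x) (q ∷ y) = cong₂ _∷_
    (solve 5 (λ a b d p q → (a :+ b) :* d :+ (p :+ q) := (a :* d :+ p) :+ (b :* d :+ q))
       refl (ℕ→ℚ a) (ℕ→ℚ b) d p q)
    (distrib δ x y)

lincombℕ-* : ∀ {m r} k (a : Vec ℕ r) (δs : Vec (V m) r) →
             lincombℕ (Vec.map (k ℕ.*_) a) δs ≡ ℕ→ℚ k *ₛ lincombℕ a δs
lincombℕ-* k [] [] = sym (*ₛ-zeroʳ (ℕ→ℚ k))
lincombℕ-* k (a ∷ as) (δ ∷ δs) rewrite ℕ→ℚ-* k a | lincombℕ-* k as δs = distrib δ (lincombℕ as δs)
  where
  distrib : ∀ {m} (δ x : V m) → ((ℕ→ℚ k * ℕ→ℚ a) *ₛ δ) +ᵥ (ℕ→ℚ k *ₛ x) ≡ ℕ→ℚ k *ₛ ((ℕ→ℚ a *ₛ δ) +ᵥ x)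
  distrib [] [] = refl
  distrib (d ∷ δ) (p ∷ x) = cong₂ _∷_
    (solve 4 (λ k a d p → (k :* a) :* d :+ k :* p := k :* (a :* d :+ p)) refl (ℕ→ℚ k) (ℕ→ℚ a) d p)
    (distrib δ x)

lincombℕ-0 : ∀ {m r} (δs : Vec (V m) r) → lincombℕ (Vec.replicate r 0) δs ≡ 0ᵥ
lincombℕ-0 [] = refl
lincombℕ-0 (δ ∷ δs) rewrite lincombℕ-0 δs = 0δ+0≡0 δ
  where
  0δ+0≡0 : ∀ {m} (δ : V m) → (0ℚ *ₛ δ) +ᵥ 0ᵥ ≡ 0ᵥ
  0δ+0≡0 [] = refl
  0δ+0≡0 (d ∷ δ) = cong₂ _∷_ (solve 1 (λ d → con 0ℚ :* d :+ con 0ℚ := con 0ℚ) refl d) (0δ+0≡0 δ)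

ℕ-sum≡0⇒≡0 : ∀ {r} (a b : Vec ℕ r) →
             Vec.map ℕ→ℚ (Vec.zipWith ℕ._+_ a b) ≡ Vec.replicate r 0ℚ → a ≡ Vec.replicate r 0
ℕ-sum≡0⇒≡0 [] [] _ = refl
ℕ-sum≡0⇒≡0 (a ∷ as) (b ∷ bs) eq = cong₂ _∷_
  (ℕP.m+n≡0⇒m≡0 a (ℕ→ℚ-injective (VecP.∷-injectiveˡ eq)))
  (ℕ-sum≡0⇒≡0 as bs (VecP.∷-injectiveʳ eq))

module _ {m r} {R : RootSystem m} (B : Base R r) where

  Cone : V m → Set
  Cone x = ∃ λ (c : Vec ℕ r) → x ≡ lincombℕ c (Δ B)

  Cone-+ᵥ : ∀ {x y} → Cone x → Cone y → Cone (x +ᵥ y)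
  Cone-+ᵥ (a , refl) (b , refl) = Vec.zipWith ℕ._+_ a b , sym (lincombℕ-+ a b (Δ B))

  Cone-*ℕ : ∀ k {x} → Cone x → Cone (ℕ→ℚ k *ₛ x)
  Cone-*ℕ k (a , refl) = Vec.map (k ℕ.*_) a , sym (lincombℕ-* k a (Δ B))

  Cone-antisym : ∀ {x} → Cone x → Cone (negᵥ x) → x ≡ 0ᵥ
  Cone-antisym {x} (a , x≡) (b , -x≡) = begin
    x                                      ≡⟨ x≡ ⟩
    lincombℕ a (Δ B)                       ≡⟨ cong (λ c → lincombℕ c (Δ B)) (ℕ-sum≡0⇒≡0 a b a+b≡0) ⟩
    lincombℕ (Vec.replicate r 0) (Δ B)     ≡⟨ lincombℕ-0 (Δ B) ⟩
    0ᵥ                                     ∎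
    where
    a+b≡0 : Vec.map ℕ→ℚ (Vec.zipWith ℕ._+_ a b) ≡ Vec.replicate r 0ℚ
    a+b≡0 = linIndep B _ (begin
      lincombℕ (Vec.zipWith ℕ._+_ a b) (Δ B)     ≡⟨ lincombℕ-+ a b (Δ B) ⟩
      lincombℕ a (Δ B) +ᵥ lincombℕ b (Δ B)       ≡⟨ cong₂ _+ᵥ_ (sym x≡) (sym -x≡) ⟩
      x -ᵥ x                                     ≡⟨ +ᵥ-inverseʳ x ⟩
      0ᵥ                                         ∎)

  Pos⇒¬Neg : ∀ {x} → Pos B x → ¬ Neg B x
  Pos⇒¬Neg {x} (x∈Φ , x≥0) (_ , -x≥0) = zero∉Φ R (subst (_∈ Φ R) (Cone-antisym x≥0 -x≥0) x∈Φ)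

  Pos⊎Neg : ∀ {x} → x ∈ Φ R → Pos B x ⊎ Neg B x
  Pos⊎Neg x∈Φ with spanning B x∈Φ
  ... | inj₁ x≥0 = inj₁ (x∈Φ , x≥0)
  ... | inj₂ (c , x≡) = inj₂ (negᵥ-∈Φ R x∈Φ , c , trans (cong negᵥ x≡) (negᵥ-involutive _))

  reflect-Neg⇒cartan-pos : ∀ {α x} → Pos B α → Pos B x → Neg B (reflect α x) →
                           ∃ λ k → cartan x α ≡ ℕ→ℚ (suc k)
  reflect-Neg⇒cartan-pos {α} {x} (α∈Φ , α≥0) x>0@(x∈Φ , x≥0) sx<0 with crystallographic R α∈Φ x∈Φ
  ... | + zero , c≡0 = ⊥-elim (Pos⇒¬Neg x>0 (subst (Neg B) (reflect-fixed c≡0) sx<0))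
  ... | + suc k , c≡k = k , c≡k
  ... | -[1+ k ] , c≡-k = ⊥-elim (Pos⇒¬Neg sx>0 sx<0)
    where
    sx>0 : Pos B (reflect α x)
    sx>0 = reflect-closed R α∈Φ x∈Φ ,
           subst Cone (sym (reflect-adds (ℕ→ℚ (suc k)) c≡-k)) (Cone-+ᵥ x≥0 (Cone-*ℕ (suc k) α≥0))

module _ {A : Set} where

  Unique-lookup-injective : ∀ {xs : List A} → Unique xs →
                            ∀ {i j} → List.lookup xs i ≡ List.lookup xs j → i ≡ j
  Unique-lookup-injective (_ ∷ _) {zero} {zero} _ = refl
  Unique-lookup-injective (x∉xs ∷ _) {zero} {suc j} eq = ⊥-elim (All.lookup x∉xs (∈-lookup j) eq)
  Unique-lookup-injective (x∉xs ∷ _) {suc i} {zero} eq = ⊥-elim (All.lookup x∉xs (∈-lookup i) (sym eq))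
  Unique-lookup-injective (_ ∷ xs!) {suc i} {suc j} eq = cong suc (Unique-lookup-injective xs! eq)

  Unique-⊆⇒length≤ : ∀ {xs ys : List A} → Unique xs → xs ⊆ ys → List.length xs ℕ.≤ List.length ys
  Unique-⊆⇒length≤ {xs} {ys} xs! xs⊆ys = injective⇒≤ {f = position} position-injective
    where
    position : Fin (List.length xs) → Fin (List.length ys)
    position = index ∘ xs⊆ys ∘ ∈-lookup
    position-injective : ∀ {i j} → position i ≡ position j → i ≡ j
    position-injective {i} {j} eq = Unique-lookup-injective xs! (begin
      List.lookup xs i            ≡⟨ lookup-index (xs⊆ys (∈-lookup i)) ⟩
      List.lookup ys (position i) ≡⟨ cong (List.lookup ys) eq ⟩
      List.lookup ys (position j) ≡⟨ sym (lookup-index (xs⊆ys (∈-lookup j))) ⟩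
      List.lookup xs j            ∎)

module _ {A B : Set} {Rel : A → B → Set} where

  All-∃⇒Pointwise : ∀ {xs} → All (λ x → ∃ (Rel x)) xs → ∃ (Pointwise Rel xs)
  All-∃⇒Pointwise [] = [] , []
  All-∃⇒Pointwise ((y , r) ∷ rs) with All-∃⇒Pointwise rs
  ... | ys , rs′ = y ∷ ys , r ∷ rs′

  Pointwise-All : ∀ {P : A → Set} {Q : B → Set} {xs ys} → (∀ {x y} → P x → Rel x y → Q y) →
                  All P xs → Pointwise Rel xs ys → All Q ys
  Pointwise-All f [] [] = []
  Pointwise-All f (p ∷ ps) (r ∷ rs) = f p r ∷ Pointwise-All f ps rs

  Pointwise-Unique : ∀ {P : A → Set} {xs ys} →
                     (∀ {x₁ x₂ y} → P x₁ → P x₂ → Rel x₁ y → Rel x₂ y → x₁ ≡ x₂) →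
                     All P xs → Unique xs → Pointwise Rel xs ys → Unique ys
  Pointwise-Unique inj [] [] [] = []
  Pointwise-Unique {P} {x ∷ _} {y ∷ _} inj (p ∷ ps) (x∉xs ∷ xs!) (r ∷ rs) =
    Pointwise-All y≢ (All.zip (x∉xs , ps)) rs ∷ Pointwise-Unique inj ps xs! rs
    where
    y≢ : ∀ {x′ y′} → x ≢ x′ × P x′ → Rel x′ y′ → y ≢ y′
    y≢ {x′} (x≢x′ , p′) r′ y≡y′ = x≢x′ (inj p p′ r (subst (Rel x′) (sym y≡y′) r′))

-- Inversion sets along Bruhat steps

module _ {m r} {R : RootSystem m} (B : Base R r) where

  -- |N v| ≥ |N u| + k, stated with duplicate-free lists since N u comes with no enumeration.
  InversionGap : W R → W R → ℕ → Set
  InversionGap u v k = ∀ L → Unique L → All (N B u) L →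
    ∃ λ L′ → Unique L′ × All (N B v) L′ × List.length L ℕ.+ k ℕ.≤ List.length L′

  InversionGap-trans : ∀ {u t v a b} → InversionGap u t a → InversionGap t v b →
                       InversionGap u v (a ℕ.+ b)
  InversionGap-trans {a = a} {b} u→t t→v L L! L⊆Nu with u→t L L! L⊆Nu
  ... | L₁ , L₁! , L₁⊆Nt , |L|+a≤|L₁| with t→v L₁ L₁! L₁⊆Nt
  ... | L₂ , L₂! , L₂⊆Nv , |L₁|+b≤|L₂| = L₂ , L₂! , L₂⊆Nv ,
    ℕP.≤-trans (ℕP.≤-reflexive (sym (ℕP.+-assoc (List.length L) a b)))
               (ℕP.≤-trans (ℕP.+-monoˡ-≤ b |L|+a≤|L₁|) |L₁|+b≤|L₂|)

  InversionGap-weaken : ∀ {u v j k} → j ℕ.≤ k → InversionGap u v k → InversionGap u v j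
  InversionGap-weaken {j = j} {k} j≤k u→v L L! L⊆Nu with u→v L L! L⊆Nu
  ... | L′ , L′! , L′⊆Nv , |L|+k≤|L′| =
    L′ , L′! , L′⊆Nv , ℕP.≤-trans (ℕP.+-monoʳ-≤ (List.length L) j≤k) |L|+k≤|L′|

  module BruhatStepInversions {u v : W R} {α : V m} (α>0 : Pos B α)
           (v≈sαu : ∀ x → act v x ≡ reflect α (act u x)) (v⁻¹α<0 : Neg B (actInv v α)) where

    α≢0 : α ≢ 0ᵥ
    α≢0 = root≢0 R (proj₁ α>0)

    actInv-v : ∀ y → actInv v y ≡ actInv u (reflect α y)
    actInv-v y = begin
      actInv v y           ≡⟨ cong (actInv v) (sym v[z]≡y) ⟩
      actInv v (act v z)   ≡⟨ actInv-act v z ⟩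
      z                    ∎
      where
      z : V m
      z = actInv u (reflect α y)
      v[z]≡y : act v z ≡ y
      v[z]≡y = trans (v≈sαu z) (trans (cong (reflect α) (act-actInv u _)) (reflect-involutive α α≢0 y))

    u⁻¹α>0 : Pos B (actInv u α)
    u⁻¹α>0 = subst (Pos B) -v⁻¹α≡u⁻¹α v⁻¹α<0
      where
      -v⁻¹α≡u⁻¹α : negᵥ (actInv v α) ≡ actInv u α
      -v⁻¹α≡u⁻¹α = begin
        negᵥ (actInv v α)                   ≡⟨ cong negᵥ (actInv-v α) ⟩
        negᵥ (actInv u (reflect α α))       ≡⟨ cong (negᵥ ∘ actInv u) (reflect-self α α≢0) ⟩
        negᵥ (actInv u (negᵥ α))            ≡⟨ cong negᵥ (actInv-negᵥ u α) ⟩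
        negᵥ (negᵥ (actInv u α))            ≡⟨ negᵥ-involutive _ ⟩
        actInv u α                          ∎

    data Image (x y : V m) : Set where
      reflected : y ≡ reflect α x → Pos B y → Image x y
      kept      : y ≡ x → Neg B (reflect α x) → Image x y

    image : ∀ {x} → N B u x → ∃ (Image x)
    image {x} (x>0 , _) with Pos⊎Neg B (reflect-closed R (proj₁ α>0) (proj₁ x>0))
    ... | inj₁ sx>0 = reflect α x , reflected refl sx>0
    ... | inj₂ sx<0 = x , kept refl sx<0

    kept-N : ∀ {x} → N B u x → Neg B (reflect α x) → Neg B (actInv v x)
    kept-N {x} (x>0 , u⁻¹x<0) sx<0 with reflect-Neg⇒cartan-pos B α>0 x>0 sx<0
    ... | k , c≡k =
      negᵥ-∈Φ R (actInv-∈Φ v (proj₁ x>0)) ,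
      subst (Cone B) (sym -v⁻¹x≡) (Cone-+ᵥ B (proj₂ u⁻¹x<0) (Cone-*ℕ B (suc k) (proj₂ u⁻¹α>0)))
      where
      -v⁻¹x≡ : negᵥ (actInv v x) ≡ negᵥ (actInv u x) +ᵥ (ℕ→ℚ (suc k) *ₛ actInv u α)
      -v⁻¹x≡ = begin
        negᵥ (actInv v x)                                 ≡⟨ cong negᵥ (actInv-v x) ⟩
        negᵥ (actInv u (reflect α x))                     ≡⟨ cong negᵥ (actInv-reflect u α x) ⟩
        negᵥ (actInv u x -ᵥ (cartan x α *ₛ actInv u α))   ≡⟨ negᵥ-distrib-ᵥ _ _ ⟩
        negᵥ (actInv u x) +ᵥ (cartan x α *ₛ actInv u α)   ≡⟨ cong (λ c → _ +ᵥ (c *ₛ actInv u α)) c≡k ⟩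
        negᵥ (actInv u x) +ᵥ (ℕ→ℚ (suc k) *ₛ actInv u α) ∎

    Image-N : ∀ {x y} → N B u x → Image x y → N B v y
    Image-N {x} (_ , u⁻¹x<0) (reflected refl sx>0) =
      sx>0 , subst (Neg B) (sym v⁻¹sx≡u⁻¹x) u⁻¹x<0
      where
      v⁻¹sx≡u⁻¹x : actInv v (reflect α x) ≡ actInv u x
      v⁻¹sx≡u⁻¹x = trans (actInv-v _) (cong (actInv u) (reflect-involutive α α≢0 x))
    Image-N x∈N (kept refl sx<0) = proj₁ x∈N , kept-N x∈N sx<0

    Image-≢α : ∀ {x y} → N B u x → Image x y → α ≢ y
    Image-≢α {x} (x>0 , _) (reflected refl _) α≡sx = Pos⇒¬Neg B α>0 (subst (Pos B) x≡-α x>0)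
      where
      x≡-α : x ≡ negᵥ α
      x≡-α = begin
        x                         ≡⟨ sym (reflect-involutive α α≢0 x) ⟩
        reflect α (reflect α x)   ≡⟨ cong (reflect α) (sym α≡sx) ⟩
        reflect α α               ≡⟨ reflect-self α α≢0 ⟩
        negᵥ α                    ∎
    Image-≢α (_ , u⁻¹x<0) (kept refl _) refl = Pos⇒¬Neg B u⁻¹α>0 u⁻¹x<0

    Pos⇒¬Neg-reflect² : ∀ {x} → Pos B x → ¬ Neg B (reflect α (reflect α x))
    Pos⇒¬Neg-reflect² {x} x>0 = Pos⇒¬Neg B x>0 ∘ subst (Neg B) (reflect-involutive α α≢0 x)

    Image-injective : ∀ {x₁ x₂ y} → N B u x₁ → N B u x₂ → Image x₁ y → Image x₂ y → x₁ ≡ x₂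
    Image-injective _ _ (reflected y≡sx₁ _) (reflected y≡sx₂ _) =
      reflect-injective α≢0 (trans (sym y≡sx₁) y≡sx₂)
    Image-injective _ _ (kept y≡x₁ _) (kept y≡x₂ _) = trans (sym y≡x₁) y≡x₂
    Image-injective (x₁>0 , _) _ (reflected y≡sx₁ _) (kept y≡x₂ sx₂<0) =
      ⊥-elim (Pos⇒¬Neg-reflect² x₁>0 (subst (Neg B ∘ reflect α) (trans (sym y≡x₂) y≡sx₁) sx₂<0))
    Image-injective _ (x₂>0 , _) (kept y≡x₁ sx₁<0) (reflected y≡sx₂ _) =
      ⊥-elim (Pos⇒¬Neg-reflect² x₂>0 (subst (Neg B ∘ reflect α) (trans (sym y≡x₁) y≡sx₂) sx₁<0))

    inversionGap : InversionGap u v 1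
    inversionGap L L! L⊆Nu with All-∃⇒Pointwise (All.map image L⊆Nu)
    ... | L′ , L~L′ =
      α ∷ L′ ,
      Pointwise-All Image-≢α L⊆Nu L~L′ ∷ Pointwise-Unique Image-injective L⊆Nu L! L~L′ ,
      (α>0 , v⁻¹α<0) ∷ Pointwise-All Image-N L⊆Nu L~L′ ,
      ℕP.≤-reflexive (trans (ℕP.+-comm (List.length L) 1) (cong suc (Pointwise-length L~L′)))

  BruhatStep⇒InversionGap : ∀ {u v} → BruhatStep B u v → InversionGap u v 1
  BruhatStep⇒InversionGap {u} {v} (α , α>0 , v≈sαu , v⁻¹α<0) =
    BruhatStepInversions.inversionGap {u} {v} α>0 v≈sαu v⁻¹α<0

  <B⇒InversionGap : ∀ {u v} → _<B_ B u v → InversionGap u v 1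
  <B⇒InversionGap {u} {v} (step s) = BruhatStep⇒InversionGap {u} {v} s
  <B⇒InversionGap {u} {v} (<B-trans {v = t} u<t t<v) =
    InversionGap-weaken {u} {v} (ℕ.s≤s ℕ.z≤n)
      (InversionGap-trans {u} {t} {v} (<B⇒InversionGap u<t) (<B⇒InversionGap t<v))

-- Bruhat relations w < v with ℓ_γ(w) = ℓ_γ(v) and v⁻¹β = -γ

module _ {m r} {R : RootSystem m} (B : Base R r) where

  N⇒≡⊎Nγ : ∀ {γ β z} {v : W R} → actInv v β ≡ negᵥ γ → N B v z → z ≡ β ⊎ Nγ B γ v z
  N⇒≡⊎Nγ {γ} {β} {z} {v} v⁻¹β≡-γ (z>0 , v⁻¹z<0) with VecP.≡-dec ℚ._≟_ (negᵥ (actInv v z)) γ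
  ... | yes -v⁻¹z≡γ = inj₁ (actInv-injective v (begin
    actInv v z                   ≡⟨ sym (negᵥ-involutive _) ⟩
    negᵥ (negᵥ (actInv v z))     ≡⟨ cong negᵥ -v⁻¹z≡γ ⟩
    negᵥ γ                       ≡⟨ sym v⁻¹β≡-γ ⟩
    actInv v β                   ∎))
  ... | no -v⁻¹z≢γ = inj₂ (z>0 , v⁻¹z<0 , -v⁻¹z≢γ)

  Nγ⇒N : ∀ {γ x} {w : W R} → Nγ B γ w x → N B w x
  Nγ⇒N (x>0 , w⁻¹x<0 , _) = x>0 , w⁻¹x<0

  SameℓΓ⇒gap≤1 : ∀ {γ β k} {w v : W R} → SameℓΓ B γ w v → actInv v β ≡ negᵥ γ →
                 InversionGap B w v k → k ℕ.≤ 1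
  SameℓΓ⇒gap≤1 {γ} {β} {k} {w} {v} (n , (Lw , Lw! , Lw⇔Nγw , |Lw|≡n) , (Lv , _ , Lv⇔Nγv , |Lv|≡n))
               v⁻¹β≡-γ w→v
    with w→v Lw Lw! (All.tabulate (Nγ⇒N {w = w} ∘ Equivalence.to (Lw⇔Nγw _)))
  ... | L , L! , L⊆Nv , |Lw|+k≤|L| =
    ℕP.+-cancelˡ-≤ n k 1 (subst₂ (λ a b → a ℕ.+ k ℕ.≤ b) |Lw|≡n (trans (cong suc |Lv|≡n) (ℕP.+-comm 1 n))
                                 (ℕP.≤-trans |Lw|+k≤|L| (Unique-⊆⇒length≤ L! L⊆β∷Lv)))
    where
    L⊆β∷Lv : L ⊆ β ∷ Lv
    L⊆β∷Lv z∈L = [ here , there ∘ Equivalence.from (Lv⇔Nγv _) ]′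
                   (N⇒≡⊎Nγ {v = v} v⁻¹β≡-γ (All.lookup L⊆Nv z∈L))

  SameℓΓ-<B⇒BruhatStep : ∀ {γ β} {w v : W R} → SameℓΓ B γ w v → actInv v β ≡ negᵥ γ →
                         _<B_ B w v → BruhatStep B w v
  SameℓΓ-<B⇒BruhatStep _ _ (step w⋖v) = w⋖v
  SameℓΓ-<B⇒BruhatStep {w = w} {v} ℓw≡ℓv v⁻¹β≡-γ (<B-trans {v = u} w<u u<v) =
    ⊥-elim (ℕP.<-irrefl refl (SameℓΓ⇒gap≤1 {w = w} {v} ℓw≡ℓv v⁻¹β≡-γ
      (InversionGap-trans B {w} {u} {v} (<B⇒InversionGap B w<u) (<B⇒InversionGap B u<v))))

  Pos-proportional⇒≡ : ∀ {α₁ α₂} d → Pos B α₁ → Pos B α₂ → α₁ ≡ d *ₛ α₂ → α₁ ≡ α₂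
  Pos-proportional⇒≡ {α₁} {α₂} d α₁>0 α₂>0 α₁≡dα₂
    with reduced R d (proj₁ α₂>0) (subst (_∈ Φ R) α₁≡dα₂ (proj₁ α₁>0))
  ... | inj₁ refl = trans α₁≡dα₂ (*ₛ-identityˡ α₂)
  ... | inj₂ refl = ⊥-elim (Pos⇒¬Neg B α₂>0 (subst (Pos B) (trans α₁≡dα₂ (sym (negᵥ≡-1*ₛ α₂))) α₁>0))

  reflect≡⇒root≡ : ∀ {α₁ α₂ x} → Pos B α₁ → Pos B α₂ →
                   reflect α₁ x ≡ reflect α₂ x → reflect α₁ x ≢ x → α₁ ≡ α₂
  reflect≡⇒root≡ {α₁} {α₂} {x} α₁>0 α₂>0 s₁x≡s₂x s₁x≢x =
    Pos-proportional⇒≡ (ℚ.1/ c₁ * c₂) α₁>0 α₂>0 (begin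
      α₁                        ≡⟨ sym (*ₛ-identityˡ α₁) ⟩
      1ℚ *ₛ α₁                  ≡⟨ cong (_*ₛ α₁) (sym (ℚP.*-inverseˡ c₁)) ⟩
      (ℚ.1/ c₁ * c₁) *ₛ α₁      ≡⟨ *ₛ-assoc (ℚ.1/ c₁) c₁ α₁ ⟩
      ℚ.1/ c₁ *ₛ (c₁ *ₛ α₁)     ≡⟨ cong (ℚ.1/ c₁ *ₛ_) (reflect≡⇒cartan*ₛ≡ s₁x≡s₂x) ⟩
      ℚ.1/ c₁ *ₛ (c₂ *ₛ α₂)     ≡⟨ sym (*ₛ-assoc (ℚ.1/ c₁) c₂ α₂) ⟩
      (ℚ.1/ c₁ * c₂) *ₛ α₂      ∎)
    where
    c₁ c₂ : ℚ
    c₁ = cartan x α₁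
    c₂ = cartan x α₂
    instance
      c₁≢0 : ℚ.NonZero c₁
      c₁≢0 = ℚ.≢-nonZero (s₁x≢x ∘ reflect-fixed)

  BruhatStep-unique : ∀ {w v₁ v₂ : W R} {β μ} → actInv w β ≢ μ →
                      BruhatStep B w v₁ → BruhatStep B w v₂ →
                      actInv v₁ β ≡ μ → actInv v₂ β ≡ μ → v₁ ≈W v₂
  BruhatStep-unique {w} {v₁} {v₂} {β} {μ} w⁻¹β≢μ (α₁ , α₁>0 , v₁≈s₁w , _) (α₂ , α₂>0 , v₂≈s₂w , _)
                    v₁⁻¹β≡μ v₂⁻¹β≡μ x =
    begin
      act v₁ x               ≡⟨ v₁≈s₁w x ⟩
      reflect α₁ (act w x)   ≡⟨ cong (λ α → reflect α (act w x)) α₁≡α₂ ⟩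
      reflect α₂ (act w x)   ≡⟨ sym (v₂≈s₂w x) ⟩
      act v₂ x               ∎
    where
    ν : V m
    ν = act w μ
    reflect-ν≡β : ∀ {v α} → (∀ y → act v y ≡ reflect α (act w y)) → actInv v β ≡ μ → reflect α ν ≡ β
    reflect-ν≡β {v} v≈sw v⁻¹β≡μ =
      trans (sym (v≈sw μ)) (trans (cong (act v) (sym v⁻¹β≡μ)) (act-actInv v β))
    s₁ν≢ν : reflect α₁ ν ≢ ν
    s₁ν≢ν s₁ν≡ν = w⁻¹β≢μ (begin
      actInv w β                   ≡⟨ cong (actInv w) (sym (reflect-ν≡β {v₁} v₁≈s₁w v₁⁻¹β≡μ)) ⟩
      actInv w (reflect α₁ ν)      ≡⟨ cong (actInv w) s₁ν≡ν ⟩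
      actInv w ν                   ≡⟨ actInv-act w μ ⟩
      μ                            ∎)
    α₁≡α₂ : α₁ ≡ α₂
    α₁≡α₂ = reflect≡⇒root≡ α₁>0 α₂>0
              (trans (reflect-ν≡β {v₁} v₁≈s₁w v₁⁻¹β≡μ) (sym (reflect-ν≡β {v₂} v₂≈s₂w v₂⁻¹β≡μ))) s₁ν≢ν

mainTheorem9 : ∀ {m r} (R : RootSystem m) (B : Base R r) → Irreducible R →
    (γ : V m) → γ ∈ Φ R → (∀ α → α ∈ Φ R → _⪯_ B α γ) →
    (w : W R) (β : V m) → Pos B β →
    (v₁ v₂ : W R) → Candidate B γ w β v₁ → Candidate B γ w β v₂ → v₁ ≈W v₂
mainTheorem9 R B _ γ _ _ w β _ v₁ v₂
             (w<v₁ , β∈Nγw , _ , ℓw≡ℓv₁ , v₁⁻¹β≡-γ) (w<v₂ , _ , _ , ℓw≡ℓv₂ , v₂⁻¹β≡-γ) =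
  BruhatStep-unique B {w} {v₁} {v₂} w⁻¹β≢-γ
    (SameℓΓ-<B⇒BruhatStep B ℓw≡ℓv₁ v₁⁻¹β≡-γ w<v₁)
    (SameℓΓ-<B⇒BruhatStep B ℓw≡ℓv₂ v₂⁻¹β≡-γ w<v₂)
    v₁⁻¹β≡-γ v₂⁻¹β≡-γ
  where
  w⁻¹β≢-γ : actInv w β ≢ negᵥ γ
  w⁻¹β≢-γ w⁻¹β≡-γ = proj₂ (proj₂ β∈Nγw) (trans (cong negᵥ w⁻¹β≡-γ) (negᵥ-involutive γ))
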